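{- Fix $n\geq1$ and $1\le i\le2^n$. Then $\mathcal A^n_i$ and $\mathcal B^n_i$ have the same critical height $m$, and they are distinguished by $m$.
   Context: Models considered are finite Kripke models $(W,R,V)$ with $R$ transitive and irreflexive, whose frame is a tree, equipped with a partial successor function $S$ sending some points to one of their daughters. For a rooted such model $\mathcal M$ with root $w_0$, its critical branch is the maximal sequence $w_0,w_1,\dots,w_m$ with $w_{t+1}=S(w_t)$, and $m$ is its critical height; $S[\mathcal M]$ is the submodel generated by $S(w_0)$. For rooted models with successors $\mathcal M,\mathcal N$ with roots $w,v$, a number $r$ distinguishes them if $S^r(w)$ and $S^r(v)$ are defined and differ on the truth of some propositional variable, while for every $t<r$, $S^t(w)$ and $S^t(v)$ agree on the truth of all propositional variables. Adding a fresh root to a model $Z$ means adding a new irreflexive point that $R$-sees every point of $Z$ and satisfies no variable. For $n\geq1$ and $1\le i\le2^n$, models $\mathcal A^n_i,\mathcal B^n_i$ with roots $a^n_i,b^n_i$ are defined by recursion: for every $n\geq0$, (i) if $i\le2^n$: when $n=0$, $\mathcal A^1_1$ is a single point where exactly $p_1$ is true and $\mathcal B^1_1$ a single point where no variable is true (empty $S$); when $n\ge1$, $\mathcal A^{n+1}_i$ (resp. $\mathcal B^{n+1}_i$) is a copy of $\mathcal A^n_i$ (resp. $\mathcal B^n_i$), same $S$, with $p_{n+1}$ additionally true at the root. (ii) if $i=2^n+j$, $1\le j\le2^n$: $\mathcal B^{n+1}_{2^n+j}$ is obtained by adding a fresh root $b$ to $\bigsqcup_{k=2}^{2^n}S[\mathcal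 A^{n+1}_k]\sqcup\mathcal B^{n+1}_j$, with successor function $S_{\mathcal B^{n+1}_j}\cup\{(b,b^{n+1}_j)\}$; $\mathcal A^{n+1}_{2^n+j}$ is obtained by adding a fresh root $a$ to $\bigsqcup_{k=2}^{2^n}S[\mathcal A^{n+1}_k]\sqcup\mathcal B^{n+1}_j\sqcup\mathcal A^{n+1}_j$, with successor function $S_{\mathcal A^{n+1}_j}\cup\{(a,a^{n+1}_j)\}$ (for $n=0$ the union over $k$ is empty). -}

module Defs where

open import Data.Nat using (ℕ; zero; suc; _+_; _∸_; _^_; _≤_; _<_; _≡ᵇ_; _≤ᵇ_)
open import Data.Bool using (Bool; true; false; if_then_else_)
open import Data.List using (List; []; _∷_; _++_; applyUpTo; concat; map)
open import Data.Maybe using (Maybe; just; nothing)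
open import Data.Product using (_×_; _,_; proj₁; proj₂; Σ; ∃)
open import Relation.Binary.PropositionalEquality using (_≡_; _≢_)

-- A finite rooted tree Kripke model with successor function.
-- node V s ds : the root has valuation V (V k = true iff p_k holds there),
-- s is its S-successor daughter (if S is defined at the root) and ds are
-- its remaining daughters.  R is the (transitive, irreflexive) ancestor
-- relation of the tree; S at every point is encoded in the same way.
data Tree : Set where
  node : (ℕ → Bool) → Maybe Tree → List Tree → Tree

val : Tree → ℕ → Bool
val (node v _ _) = v

-- S[M] : the submodel generated by S(root), as a (possibly empty) forest
Ssub : Tree → List Tree
Ssub (node _ (just t) _) = t ∷ []
Ssub (node _ nothing _)  = []

Siter : ℕ → Tree → Maybe Tree
Siter zero    t                    = just t
Siter (suc r) (node _ (just t) _)  = Siter r t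
Siter (suc r) (node _ nothing _)   = nothing

-- critical height: length m of the critical branch w0,...,wm
critHeight : Tree → ℕ
critHeight (node _ (just t) _) = suc (critHeight t)
critHeight (node _ nothing _)  = 0

Distinguishes : ℕ → Tree → Tree → Set
Distinguishes r M N =
  Σ Tree (λ x → Σ Tree (λ y →
    (Siter r M ≡ just x) × (Siter r N ≡ just y) × ∃ (λ k → val x k ≢ val y k)))
  × (∀ t → t < r → ∀ x y → Siter t M ≡ just x → Siter t N ≡ just y →
       ∀ k → val x k ≡ val y k)

addVar : ℕ → Tree → Tree
addVar k (node v s ds) = node (λ x → if x ≡ᵇ k then true else v x) s ds

noVar : ℕ → Bool
noVar _ = false

onlyP1 : ℕ → Bool
onlyP1 x = x ≡ᵇ 1

mapBoth : (Tree → Tree) → Tree × Tree → Tree × Tree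
mapBoth f (a , b) = f a , f b

mutual
  -- low N i = (A^{N+1}_i , B^{N+1}_i) for 1 ≤ i ≤ 2^N
  low : ℕ → ℕ → Tree × Tree
  low zero    i = node onlyP1 nothing [] , node noVar nothing []
  low (suc N) i = mapBoth (addVar (suc (suc N))) (full N i)

  -- full N i = (A^{N+1}_i , B^{N+1}_i) for 1 ≤ i ≤ 2^{N+1}
  full : ℕ → ℕ → Tree × Tree
  full N i = if i ≤ᵇ 2 ^ N then low N i else high N (i ∸ 2 ^ N)

  -- high N j = (A^{N+1}_{2^N+j} , B^{N+1}_{2^N+j}) for 1 ≤ j ≤ 2^N
  high : ℕ → ℕ → Tree × Tree
  high N j =
    node noVar (just (proj₁ (low N j))) (rest ++ (proj₂ (low N j) ∷ [])) ,
    node noVar (just (proj₂ (low N j))) rest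
    where
    -- ⨆_{k=2}^{2^N} S[A^{N+1}_k]
    rest : List Tree
    rest = concat (applyUpTo (λ k → Ssub (proj₁ (low N (k + 2)))) (2 ^ N ∸ 1))

-- 𝒜^n_i and ℬ^n_i (meaningful for n ≥ 1, 1 ≤ i ≤ 2^n)
𝒜 : ℕ → ℕ → Tree
𝒜 n i = proj₁ (full (n ∸ 1) i)

ℬ : ℕ → ℕ → Tree
ℬ n i = proj₂ (full (n ∸ 1) i)

module Submission where

-- Every point on the critical branch of A^n_i and B^n_i agrees
-- with its counterpart, except the last one (the tip), where p₁ differs: the
-- branch of A^1_1 / B^1_1 is a single point separated by p₁, and the two
-- constructions only (a) make a variable p_k with k ≥ 2 true at both roots,
-- or (b) put a fresh root without variables on top of A^n_j / B^n_j, with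
-- S pointing to the old roots.  Neither operation disturbs agreement along
-- the branches or the difference in p₁ at the tips.
--
-- The invariant holds
-- for all indices, so the range hypotheses of the theorem are not needed.

open import Defs
open import Data.Nat using (ℕ; zero; suc; _≤_; _<_; _^_; _∸_; _≡ᵇ_; _≤ᵇ_; s≤s)
open import Data.Nat.Properties using (≡ᵇ⇒≡)
open import Data.Bool using (true; false; if_then_else_)
open import Data.Maybe using (just; nothing)
open import Data.Product using (_×_; _,_)
open import Data.List using (List; [])
open import Data.Empty using (⊥-elim)
open import Relation.Binary.PropositionalEquality
  using (_≡_; _≢_; refl; sym; trans; cong; subst)

tip : Tree → Tree
tip (node v (just s) ds) = tip s
tip t@(node v nothing ds) = t

Siter-critHeight : ∀ t → Siter (critHeight t) t ≡ just (tip t)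
Siter-critHeight (node v (just s) ds) = Siter-critHeight s
Siter-critHeight (node v nothing ds)  = refl

AgreeBelow : ℕ → Tree → Tree → Set
AgreeBelow r M N = ∀ t → t < r → ∀ x y → Siter t M ≡ just x → Siter t N ≡ just y →
  ∀ j → val x j ≡ val y j

record SeparatedBy (k : ℕ) (M N : Tree) : Set where
  constructor separated
  field
    sameHeight : critHeight M ≡ critHeight N
    tipsDiffer : val (tip M) k ≢ val (tip N) k
    agreeBelow : AgreeBelow (critHeight M) M N

separated⇒distinguished : ∀ {k M N} → SeparatedBy k M N →
  (critHeight M ≡ critHeight N) × Distinguishes (critHeight M) M N
separated⇒distinguished {k} {M} {N} (separated same differ agree) =
  same , (tip M , tip N , Siter-critHeight M , reachN , k , differ) , agree
  where
  reachN : Siter (critHeight M) N ≡ just (tip N)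
  reachN = subst (λ h → Siter h N ≡ just (tip N)) (sym same) (Siter-critHeight N)

separated-leaves : ∀ {k v w} → v k ≢ w k →
  SeparatedBy k (node v nothing []) (node w nothing [])
separated-leaves differ = separated refl differ (λ { _ () })

val-addVar-other : ∀ {k j} → j ≢ k → ∀ t → val (addVar k t) j ≡ val t j
val-addVar-other {k} {j} j≢k (node v s ds) with j ≡ᵇ k | ≡ᵇ⇒≡ j k
... | false | _   = refl
... | true  | j≡k = ⊥-elim (j≢k (j≡k _))

critHeight-addVar : ∀ k t → critHeight (addVar k t) ≡ critHeight t
critHeight-addVar k (node v (just s) ds) = refl
critHeight-addVar k (node v nothing ds)  = refl

Siter-addVar-suc : ∀ k r t → Siter (suc r) (addVar k t) ≡ Siter (suc r) t
Siter-addVar-suc k r (node v (just s) ds) = refl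
Siter-addVar-suc k r (node v nothing ds)  = refl

-- The tip either lies below the root (untouched) or is the root itself.
val-tip-addVar-other : ∀ {k j} → j ≢ k → ∀ t → val (tip (addVar k t)) j ≡ val (tip t) j
val-tip-addVar-other j≢k (node v (just s) ds) = refl
val-tip-addVar-other j≢k t@(node v nothing ds) = val-addVar-other j≢k t

agreeBelow-addVar : ∀ k r M N → AgreeBelow r M N → AgreeBelow r (addVar k M) (addVar k N)
agreeBelow-addVar k r M@(node v s ds) N@(node w s′ es) agree zero lt _ _ refl refl j =
  cong (if j ≡ᵇ k then true else_) (agree zero lt M N refl refl j)
agreeBelow-addVar k r M N agree (suc t) lt x y reachM reachN =
  agree (suc t) lt x y (trans (sym (Siter-addVar-suc k t M)) reachM)
                       (trans (sym (Siter-addVar-suc k t N)) reachN)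

separated-addVar : ∀ {j k M N} → j ≢ k → SeparatedBy j M N →
  SeparatedBy j (addVar k M) (addVar k N)
separated-addVar {j} {k} {M} {N} j≢k (separated same differ agree) =
  separated sameHeight tipsDiffer agreeBelow
  where
  sameHeight : critHeight (addVar k M) ≡ critHeight (addVar k N)
  sameHeight = trans (critHeight-addVar k M) (trans same (sym (critHeight-addVar k N)))

  tipsDiffer : val (tip (addVar k M)) j ≢ val (tip (addVar k N)) j
  tipsDiffer eq = differ (trans (sym (val-tip-addVar-other j≢k M))
                           (trans eq (val-tip-addVar-other j≢k N)))

  agreeBelow : AgreeBelow (critHeight (addVar k M)) (addVar k M) (addVar k N)
  agreeBelow = subst (λ r → AgreeBelow r (addVar k M) (addVar k N))
                     (sym (critHeight-addVar k M))
                     (agreeBelow-addVar k (critHeight M) M N agree)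

separated-freshRoot : ∀ {k A B} v (rs ts : List Tree) → SeparatedBy k A B →
  SeparatedBy k (node v (just A) rs) (node v (just B) ts)
separated-freshRoot {k} {A} {B} v rs ts (separated same differ agree) =
  separated (cong suc same) differ agreeBelow
  where
  agreeBelow : AgreeBelow (suc (critHeight A)) (node v (just A) rs) (node v (just B) ts)
  agreeBelow zero    _        _ _ refl  refl  j = refl
  agreeBelow (suc t) (s≤s lt) x y reachA reachB j = agree t lt x y reachA reachB j

SeparatedPair : ℕ → Tree × Tree → Set
SeparatedPair k (M , N) = SeparatedBy k M N

mutual
  separated-low : ∀ N i → SeparatedPair 1 (low N i)
  separated-low zero    i = separated-leaves (λ ())
  separated-low (suc N) i = separated-addVar (λ ()) (separated-full N i)

  separated-full : ∀ N i → SeparatedPair 1 (full N i)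
  separated-full N i with i ≤ᵇ 2 ^ N
  ... | true  = separated-low N i
  ... | false = separated-high N (i ∸ 2 ^ N)

  separated-high : ∀ N j → SeparatedPair 1 (high N j)
  separated-high N j = separated-freshRoot noVar _ _ (separated-low N j)

lemma7p11 : (n i : ℕ) → 1 ≤ n → 1 ≤ i → i ≤ 2 ^ n →
    (critHeight (𝒜 n i) ≡ critHeight (ℬ n i)) × Distinguishes (critHeight (𝒜 n i)) (𝒜 n i) (ℬ n i)
lemma7p11 n i _ _ _ = separated⇒distinguished (separated-full (n ∸ 1) i)
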